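{- Let $\mathcal{F}=\langle W,R,\{S_x\}_{x\in W}\rangle$ be a Veltman frame, let $f,g$ be ultrafilters on $W$, and let $l\subseteq\wp(W)\setminus\{\emptyset\}$ have the finite intersection property. If $f\prec_l g$, then $R^{ -1}(S)\in f$ for every $S\in l$.
   Context: A Veltman frame is $\langle W,R,\{S_w\}\rangle$ where: - $W$ is nonempty. - $R$ is transitive and conversely well-founded. - Each $S_w$ is a reflexive transitive relation on $R[w]=\{v:wRv\}$ containing $R\cap R[w]^2$. For $X,Y\subseteq W$: - $\overline{Y}=W\setminus Y$. - $R^{ -1}(Y)=\{w:\exists y\in Y\,wRy\}$. - $\widehat{R^{ -1}}(Y)=\{x:\forall y(xRy\to y\in Y)\}$. - $S^{ -1}(X,Y)=\{w:\forall x\in X(wRx\to\exists y\in Y\,xS_wy)\}$. For a family $l\subseteq\wp(W)$ and ultrafilters $f,g$, $f\prec_l g$ means the following: for every $A\subseteq W$ and every finite (possibly empty) family $S_1,\dots,S_n\in l$, if $S^{ -1}(\overline{A},\overline{S_1}\cup\dots\cup\overline{S_n})\in f$ then $A\in g$ and $\widehat{R^{ -1}}(A)\in g$. -}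

module Defs where

open import Level using (0ℓ)
open import Data.Product using (Σ; ∃; _×_; _,_)
open import Data.Sum using (_⊎_)
open import Data.Empty using (⊥)
open import Data.Unit using (⊤)
open import Data.List using (List; []; _∷_)
open import Data.List.Relation.Unary.All using (All)
open import Data.List.Relation.Unary.Any using (Any)
open import Function using (flip)
open import Relation.Nullary using (¬_)
open import Relation.Unary using (Pred; _∈_; _∉_; _⊆_; ∁; _∩_; Satisfiable)
open import Induction.WellFounded using (WellFounded)

Subset : Set → Set₁
Subset W = Pred W 0ℓ

Family : Set → Set₁
Family W = Pred (Subset W) 0ℓ

-- Veltman frame ⟨W, R, {S_w}⟩.  S w x y  means  x S_w y.
record VeltmanFrame : Set₁ where
  field
    W       : Set
    R       : W → W → Set
    nonempty : W
    R-trans : ∀ {x y z} → R x y → R y z → R x z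
    R-cwf   : WellFounded (flip R)
    S       : W → W → W → Set
    S-dom   : ∀ {w x y} → S w x y → R w x × R w y
    S-refl  : ∀ {w x} → R w x → S w x x
    S-trans : ∀ {w x y z} → S w x y → S w y z → S w x z
    R⊆S     : ∀ {w x y} → R w x → R w y → R x y → S w x y

module _ (F : VeltmanFrame) where
  open VeltmanFrame F

  R⁻¹ : Subset W → Subset W
  R⁻¹ Y w = ∃ λ y → R w y × y ∈ Y

  R⁻¹̂ : Subset W → Subset W
  R⁻¹̂ Y x = ∀ y → R x y → y ∈ Y

  S⁻¹ : Subset W → Subset W → Subset W
  S⁻¹ X Y w = ∀ x → x ∈ X → R w x → ∃ λ y → y ∈ Y × S w x y

  ⋃∁ : List (Subset W) → Subset W
  ⋃∁ []       w = ⊥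
  ⋃∁ (T ∷ Ss) w = (w ∉ T) ⊎ ⋃∁ Ss w

  _≺[_]_ : Family W → Family W → Family W → Set₁
  f ≺[ l ] g = ∀ (A : Subset W) (Ss : List (Subset W)) → All (λ T → T ∈ l) Ss →
               S⁻¹ (∁ A) (⋃∁ Ss) ∈ f → (A ∈ g × R⁻¹̂ A ∈ g)

record IsUltrafilter {W : Set} (f : Family W) : Set₁ where
  field
    top     : (λ _ → ⊤) ∈ f
    proper  : (λ _ → ⊥) ∉ f
    ∩-closed : ∀ {A B} → A ∈ f → B ∈ f → (A ∩ B) ∈ f
    up-closed : ∀ {A B} → A ⊆ B → A ∈ f → B ∈ f
    ultra   : ∀ A → A ∈ f ⊎ ∁ A ∈ f

FIP : {W : Set} → Family W → Set₁
FIP {W} l = ∀ (Ss : List (Subset W)) → All (λ T → T ∈ l) Ss →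
            ∃ λ w → All (λ T → w ∈ T) Ss

NonemptyMembers : {W : Set} → Family W → Set₁
NonemptyMembers l = ∀ S → S ∈ l → Satisfiable S

{-# OPTIONS --safe #-}
module Submission where

open import Defs
open import Data.Empty using (⊥-elim)
open import Data.List using ([]; _∷_)
open import Data.List.Relation.Unary.All using (All; []; _∷_)
open import Data.Product using (_,_; proj₁)
open import Data.Sum using (inj₁; inj₂)
open import Relation.Unary using (_∈_; _∉_; _⊆_; ∁; ∅)

-- If R⁻¹(S) ∉ f then its complement lies in f, and every world there satisfies
-- S⁻¹(W, ∁ S) by reflexivity of S_w.  Taking A = ∅ and the single list [S] in the
-- definition of f ≺_l g then puts ∅ into g.

module _ (F : VeltmanFrame) where
  open VeltmanFrame F

  ∁R⁻¹⊆S⁻¹-∁ : ∀ (X T : Subset W) → ∁ (R⁻¹ F T) ⊆ S⁻¹ F X (⋃∁ F (T ∷ []))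
  ∁R⁻¹⊆S⁻¹-∁ X T w∉R⁻¹T x _ wRx = x , inj₁ (λ x∈T → w∉R⁻¹T (x , wRx , x∈T)) , S-refl wRx

  ≺-S⁻¹-∉ : ∀ {f g l : Family W} → ∅ ∉ g → _≺[_]_ F f l g →
            ∀ Ss → All (_∈ l) Ss → S⁻¹ F (∁ ∅) (⋃∁ F Ss) ∉ f
  ≺-S⁻¹-∉ ∅∉g f≺g Ss Ss⊆l S⁻¹∈f = ∅∉g (proj₁ (f≺g ∅ Ss Ss⊆l S⁻¹∈f))

corollary5p3 : (F : VeltmanFrame) → (let open VeltmanFrame F in
    (f g l : Family W) → IsUltrafilter f → IsUltrafilter g →
    NonemptyMembers l → FIP l → _≺[_]_ F f l g →
    ∀ S → S ∈ l → R⁻¹ F S ∈ f)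
corollary5p3 F f g l uf ug _ _ f≺g S S∈l with IsUltrafilter.ultra uf (R⁻¹ F S)
... | inj₁ R⁻¹S∈f = R⁻¹S∈f
... | inj₂ ∁R⁻¹S∈f =
  ⊥-elim (≺-S⁻¹-∉ F {f = f} (IsUltrafilter.proper ug) f≺g (S ∷ []) (S∈l ∷ []) S⁻¹∈f)
  where
  S⁻¹∈f : S⁻¹ F (∁ ∅) (⋃∁ F (S ∷ [])) ∈ f
  S⁻¹∈f = IsUltrafilter.up-closed uf (∁R⁻¹⊆S⁻¹-∁ F (∁ ∅) S) ∁R⁻¹S∈f
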